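{- Let $R$ be a monad on a category $\mathcal{C}$ having finite sums and a final object, and let $\mathcal{D}$ be a cartesian category. Then derivation $M\mapsto M'$, $\tau\mapsto\tau\,\mathsf{Maybe}$, is an endofunctor of $\mathrm{Mod}^{\mathcal{D}}(R)$ which preserves finite products.
   Context: A monad on $\mathcal{C}$ is $(R,\mu,\eta)$ with $R\colon\mathcal{C}\to\mathcal{C}$ a functor and natural transformations $\mu\colon R\circ R\to R$, $\eta\colon I\to R$ satisfying $\mu\circ R\mu=\mu\circ\mu R$ and $\mu\circ\eta R=\mu\circ R\eta=1_R$. A left $R$-module with range $\mathcal{D}$ is a functor $M\colon\mathcal{C}\to\mathcal{D}$ with a natural transformation $\rho\colon M\circ R\to M$ such that $\rho\circ M\mu=\rho\circ\rho R$ and $\rho\circ M\eta=1_M$. A natural transformation $\tau\colon M\to N$ of left $R$-modules is linear if $\rho_N\circ\tau R=\tau\circ\rho_M$. $\mathrm{Mod}^{\mathcal{D}}(R)$ is the category of left $R$-modules with range $\mathcal{D}$ and linear natural transformations; products of modules are pointwise products of functors with the induced action. $\mathsf{Maybe}\colon\mathcal{C}\to\mathcal{C}$ is $X\mapsto X+*$ ($*$ the final object). The derivative of a left $R$-module $M$ is $M'=M\circ\mathsf{Maybe}$ with action $M\circ\mathsf{Maybe}\circ R\xrightarrow{M\gamma}M\circ R\circ\mathsf{Maybe}\xrightarrow{\rho\,\mathsf{Maybe}}M\circ\mathsf{Maybe}$, where $\gamma_X\colon R(X)+*\to R(X+*)$ is the natural arrow with components $R(\mathrm{inl})$ and $\eta_{X+*}\circ\mathrm{inr}$.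 -}

module Defs where

open import Level using (Level; _⊔_) renaming (suc to lsuc)
open import Relation.Binary using (Rel; IsEquivalence; Setoid)
open import Data.Product using (Σ; _×_; _,_)
import Relation.Binary.Reasoning.Setoid as SetoidR

record Category (o ℓ e : Level) : Set (lsuc (o ⊔ ℓ ⊔ e)) where
  infix  4 _≈_
  infixr 9 _∘_
  field
    Obj       : Set o
    _⇒_       : Obj → Obj → Set ℓ
    _≈_       : ∀ {A B} → Rel (A ⇒ B) e
    id        : ∀ {A} → A ⇒ A
    _∘_       : ∀ {A B C} → B ⇒ C → A ⇒ B → A ⇒ C
    equiv     : ∀ {A B} → IsEquivalence (_≈_ {A} {B})
    ∘-resp-≈  : ∀ {A B C} {f h : B ⇒ C} {g i : A ⇒ B} →
                f ≈ h → g ≈ i → f ∘ g ≈ h ∘ i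
    identityˡ : ∀ {A B} {f : A ⇒ B} → id ∘ f ≈ f
    identityʳ : ∀ {A B} {f : A ⇒ B} → f ∘ id ≈ f
    assoc     : ∀ {A B C D} {f : A ⇒ B} {g : B ⇒ C} {h : C ⇒ D} →
                (h ∘ g) ∘ f ≈ h ∘ (g ∘ f)

  hom-setoid : ∀ {A B} → Setoid ℓ e
  hom-setoid {A} {B} = record { Carrier = A ⇒ B ; _≈_ = _≈_ ; isEquivalence = equiv }

  module Eq {A B} = IsEquivalence (equiv {A} {B})

  refl≈ : ∀ {A B} {f : A ⇒ B} → f ≈ f
  refl≈ = IsEquivalence.refl equiv
  sym≈ : ∀ {A B} {f g : A ⇒ B} → f ≈ g → g ≈ f
  sym≈ = IsEquivalence.sym equiv
  trans≈ : ∀ {A B} {f g h : A ⇒ B} → f ≈ g → g ≈ h → f ≈ h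
  trans≈ = IsEquivalence.trans equiv

  glue : ∀ {A B C D E F} {a : C ⇒ D} {b : B ⇒ C} {c : A ⇒ B}
           {f : A ⇒ F} {d : E ⇒ D} {e' : F ⇒ E} {g' : F ⇒ C} →
         b ∘ c ≈ g' ∘ f → a ∘ g' ≈ d ∘ e' → (a ∘ b) ∘ c ≈ d ∘ (e' ∘ f)
  glue {a = a} {b} {c} {f = f} {d} {e'} {g'} p q =
    trans≈ assoc
     (trans≈ (∘-resp-≈ refl≈ p)
      (trans≈ (sym≈ assoc)
       (trans≈ (∘-resp-≈ q refl≈) assoc)))

module _ {o ℓ e} (C : Category o ℓ e) where
  open Category C

  IsTerminal : Obj → Set (o ⊔ ℓ ⊔ e)
  IsTerminal T = ∀ A → Σ (A ⇒ T) λ ! → ∀ (h : A ⇒ T) → h ≈ !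

  IsInitial : Obj → Set (o ⊔ ℓ ⊔ e)
  IsInitial I = ∀ A → Σ (I ⇒ A) λ ! → ∀ (h : I ⇒ A) → h ≈ !

  IsProduct : ∀ {A B P} → P ⇒ A → P ⇒ B → Set (o ⊔ ℓ ⊔ e)
  IsProduct {A} {B} {P} π₁ π₂ =
    ∀ Q (f : Q ⇒ A) (g : Q ⇒ B) →
      Σ (Q ⇒ P) λ h → (π₁ ∘ h ≈ f) × (π₂ ∘ h ≈ g) ×
        (∀ (h' : Q ⇒ P) → π₁ ∘ h' ≈ f → π₂ ∘ h' ≈ g → h' ≈ h)

  record Terminal : Set (o ⊔ ℓ ⊔ e) where
    field
      ⊤          : Obj
      ⊤-terminal : IsTerminal ⊤

  record Initial : Set (o ⊔ ℓ ⊔ e) where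
    field
      ⊥         : Obj
      ⊥-initial : IsInitial ⊥

  record BinaryProducts : Set (o ⊔ ℓ ⊔ e) where
    field
      _×ₒ_    : Obj → Obj → Obj
      p₁      : ∀ {A B} → (A ×ₒ B) ⇒ A
      p₂      : ∀ {A B} → (A ×ₒ B) ⇒ B
      product : ∀ {A B} → IsProduct (p₁ {A} {B}) p₂

  record BinaryCoproducts : Set (o ⊔ ℓ ⊔ e) where
    infixr 6 _+_
    field
      _+_      : Obj → Obj → Obj
      i₁       : ∀ {A B} → A ⇒ (A + B)
      i₂       : ∀ {A B} → B ⇒ (A + B)
      [_,_]    : ∀ {A B X} → A ⇒ X → B ⇒ X → (A + B) ⇒ X
      inject₁  : ∀ {A B X} {f : A ⇒ X} {g : B ⇒ X} → [ f , g ] ∘ i₁ ≈ f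
      inject₂  : ∀ {A B X} {f : A ⇒ X} {g : B ⇒ X} → [ f , g ] ∘ i₂ ≈ g
      unique   : ∀ {A B X} {f : A ⇒ X} {g : B ⇒ X} {h : (A + B) ⇒ X} →
                 h ∘ i₁ ≈ f → h ∘ i₂ ≈ g → [ f , g ] ≈ h

module _ {o ℓ e o' ℓ' e'} (C : Category o ℓ e) (D : Category o' ℓ' e') where
  private
    module C = Category C
    module D = Category D

  record IsFunctor (F₀ : C.Obj → D.Obj)
                   (F₁ : ∀ {A B} → A C.⇒ B → F₀ A D.⇒ F₀ B)
                   : Set (o ⊔ ℓ ⊔ e ⊔ e') where
    field
      identity     : ∀ {A} → F₁ (C.id {A}) D.≈ D.id
      homomorphism : ∀ {A B X} {f : A C.⇒ B} {g : B C.⇒ X} →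
                     F₁ (g C.∘ f) D.≈ F₁ g D.∘ F₁ f
      F-resp-≈     : ∀ {A B} {f g : A C.⇒ B} → f C.≈ g → F₁ f D.≈ F₁ g

  record Functor : Set (o ⊔ ℓ ⊔ e ⊔ o' ⊔ ℓ' ⊔ e') where
    field
      F₀        : C.Obj → D.Obj
      F₁        : ∀ {A B} → A C.⇒ B → F₀ A D.⇒ F₀ B
      isFunctor : IsFunctor F₀ F₁
    open IsFunctor isFunctor public

  IsNatural : (F G : Functor) →
              (∀ X → Functor.F₀ F X D.⇒ Functor.F₀ G X) → Set (o ⊔ ℓ ⊔ e')
  IsNatural F G τ = ∀ {X Y} (f : X C.⇒ Y) →
    τ Y D.∘ Functor.F₁ F f D.≈ Functor.F₁ G f D.∘ τ X

  PreservesFiniteProducts : Functor → Set (o ⊔ ℓ ⊔ e ⊔ o' ⊔ ℓ' ⊔ e')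
  PreservesFiniteProducts F =
    (∀ T → IsTerminal C T → IsTerminal D (F₀ T)) ×
    (∀ {A B P} (π₁ : P C.⇒ A) (π₂ : P C.⇒ B) →
       IsProduct C π₁ π₂ → IsProduct D (F₁ π₁) (F₁ π₂))
    where open Functor F

_∘F_ : ∀ {o₁ ℓ₁ e₁ o₂ ℓ₂ e₂ o₃ ℓ₃ e₃}
         {B : Category o₁ ℓ₁ e₁} {C : Category o₂ ℓ₂ e₂} {D : Category o₃ ℓ₃ e₃} →
       Functor C D → Functor B C → Functor B D
_∘F_ {D = D} G F = record
  { F₀ = λ X → G.F₀ (F.F₀ X)
  ; F₁ = λ f → G.F₁ (F.F₁ f)
  ; isFunctor = record
    { identity     = D.trans≈ (G.F-resp-≈ F.identity) G.identity
    ; homomorphism = D.trans≈ (G.F-resp-≈ F.homomorphism) G.homomorphism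
    ; F-resp-≈     = λ p → G.F-resp-≈ (F.F-resp-≈ p)
    }
  }
  where
    module G = Functor G
    module F = Functor F
    module D = Category D

idF : ∀ {o ℓ e} {C : Category o ℓ e} → Functor C C
idF {C = C} = record
  { F₀ = λ X → X ; F₁ = λ f → f
  ; isFunctor = record { identity = refl≈ ; homomorphism = refl≈ ; F-resp-≈ = λ p → p } }
  where open Category C

module _ {o ℓ e} (C : Category o ℓ e) where
  open Category C

  record Monad : Set (o ⊔ ℓ ⊔ e) where
    field
      R         : Functor C C
    open Functor R public renaming (F₀ to R₀; F₁ to R₁)
    field
      μ         : ∀ X → R₀ (R₀ X) ⇒ R₀ X
      η         : ∀ X → X ⇒ R₀ X
      μ-natural : IsNatural C C (R ∘F R) R μ
      η-natural : IsNatural C C idF R η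
      μ-assoc   : ∀ {X} → μ X ∘ R₁ (μ X) ≈ μ X ∘ μ (R₀ X)
      μ-unitˡ   : ∀ {X} → μ X ∘ η (R₀ X) ≈ id
      μ-unitʳ   : ∀ {X} → μ X ∘ R₁ (η X) ≈ id

module Modules {o ℓ e o' ℓ' e'}
  (C : Category o ℓ e) (D : Category o' ℓ' e') (RM : Monad C) where

  private
    module C = Category C
    module D = Category D
    L = o ⊔ ℓ ⊔ e ⊔ o' ⊔ ℓ' ⊔ e'
  open Monad RM

  record IsModule (M : Functor C D)
                  (ρ : ∀ X → Functor.F₀ M (R₀ X) D.⇒ Functor.F₀ M X) : Set L where
    open Functor M renaming (F₀ to M₀; F₁ to M₁)
    field
      ρ-natural : IsNatural C D (M ∘F R) M ρ
      ρ-assoc   : ∀ {X} → ρ X D.∘ M₁ (μ X) D.≈ ρ X D.∘ ρ (R₀ X)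
      ρ-unit    : ∀ {X} → ρ X D.∘ M₁ (η X) D.≈ D.id

  record Module : Set L where
    field
      M        : Functor C D
    open Functor M public renaming (F₀ to M₀; F₁ to M₁)
    field
      ρ        : ∀ X → M₀ (R₀ X) D.⇒ M₀ X
      isModule : IsModule M ρ
    open IsModule isModule public

  IsLinear : (M N : Module) →
             (∀ X → Module.M₀ M X D.⇒ Module.M₀ N X) → Set (o ⊔ e')
  IsLinear M N τ = ∀ X → Module.ρ N X D.∘ τ (R₀ X) D.≈ τ X D.∘ Module.ρ M X

  record LinearNT (M N : Module) : Set L where
    field
      τ       : ∀ X → Module.M₀ M X D.⇒ Module.M₀ N X
      natural : IsNatural C D (Module.M M) (Module.M N) τ
      linear  : IsLinear M N τ

  record _≈ᴸ_ {M N : Module} (σ τ : LinearNT M N) : Set L where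
    constructor ≈ᴸ-intro
    field
      pointwise : ∀ X → LinearNT.τ σ X D.≈ LinearNT.τ τ X

  idᴸ : ∀ {M} → LinearNT M M
  idᴸ {M} = record
    { τ = λ X → D.id
    ; natural = λ f → D.trans≈ D.identityˡ (D.sym≈ D.identityʳ)
    ; linear  = λ X → D.trans≈ D.identityʳ (D.sym≈ D.identityˡ) }

  _∘ᴸ_ : ∀ {M N P} → LinearNT N P → LinearNT M N → LinearNT M P
  _∘ᴸ_ σ τ = record
    { τ = λ X → S.τ X D.∘ T.τ X
    ; natural = λ f → D.glue (T.natural f) (S.natural f)
    ; linear  = λ X → D.sym≈ (D.glue (D.sym≈ (T.linear X)) (D.sym≈ (S.linear X))) }
    where
      module S = LinearNT σ
      module T = LinearNT τ

  Mod : Category L L L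
  Mod = record
    { Obj = Module
    ; _⇒_ = LinearNT
    ; _≈_ = _≈ᴸ_
    ; id  = idᴸ
    ; _∘_ = _∘ᴸ_
    ; equiv = record
      { refl  = ≈ᴸ-intro (λ X → D.refl≈)
      ; sym   = λ p → ≈ᴸ-intro (λ X → D.sym≈ (_≈ᴸ_.pointwise p X))
      ; trans = λ p q → ≈ᴸ-intro (λ X → D.trans≈ (_≈ᴸ_.pointwise p X) (_≈ᴸ_.pointwise q X)) }
    ; ∘-resp-≈  = λ p q → ≈ᴸ-intro (λ X → D.∘-resp-≈ (_≈ᴸ_.pointwise p X) (_≈ᴸ_.pointwise q X))
    ; identityˡ = ≈ᴸ-intro (λ X → D.identityˡ)
    ; identityʳ = ≈ᴸ-intro (λ X → D.identityʳ)
    ; assoc     = ≈ᴸ-intro (λ X → D.assoc)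
    }

module Derivation {o ℓ e o' ℓ' e'}
  (C : Category o ℓ e) (D : Category o' ℓ' e')
  (cop : BinaryCoproducts C) (term : Terminal C) (RM : Monad C) where

  private
    module C = Category C
    module D = Category D
  open BinaryCoproducts cop
  open Terminal term
  open Monad RM
  open Modules C D RM

  Maybe₀ : C.Obj → C.Obj
  Maybe₀ X = X + ⊤

  Maybe₁ : ∀ {X Y} → X C.⇒ Y → Maybe₀ X C.⇒ Maybe₀ Y
  Maybe₁ f = [ i₁ C.∘ f , i₂ ]

  private
    Maybe-hom : ∀ {A B X} {f : A C.⇒ B} {g : B C.⇒ X} →
                Maybe₁ (g C.∘ f) C.≈ Maybe₁ g C.∘ Maybe₁ f
    Maybe-hom {f = f} {g} = unique
      (C.trans≈ C.assoc (C.trans≈ (C.∘-resp-≈ C.refl≈ inject₁)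
        (C.trans≈ (C.sym≈ C.assoc) (C.trans≈ (C.∘-resp-≈ inject₁ C.refl≈) C.assoc))))
      (C.trans≈ C.assoc (C.trans≈ (C.∘-resp-≈ C.refl≈ inject₂) inject₂))

  MaybeF : Functor C C
  MaybeF = record
    { F₀ = Maybe₀
    ; F₁ = Maybe₁
    ; isFunctor = record
      { identity = unique (C.trans≈ C.identityˡ (C.sym≈ C.identityʳ)) C.identityˡ
      ; homomorphism = Maybe-hom
      ; F-resp-≈ = λ p → unique (C.trans≈ inject₁ (C.∘-resp-≈ C.refl≈ (C.sym≈ p))) inject₂
      }
    }

  γ : ∀ X → Maybe₀ (R₀ X) C.⇒ R₀ (Maybe₀ X)
  γ X = [ R₁ i₁ , η (Maybe₀ X) C.∘ i₂ ]

  derivFunctor : Module → Functor C D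
  derivFunctor M = Module.M M ∘F MaybeF

  derivAction : (M : Module) → ∀ X →
                Module.M₀ M (Maybe₀ (R₀ X)) D.⇒ Module.M₀ M (Maybe₀ X)
  derivAction M X = Module.ρ M (Maybe₀ X) D.∘ Module.M₁ M (γ X)

  derivComponents : ∀ {M N : Module} → LinearNT M N →
                    ∀ X → Module.M₀ M (Maybe₀ X) D.⇒ Module.M₀ N (Maybe₀ X)
  derivComponents τ X = LinearNT.τ τ (Maybe₀ X)

  module _ (isMod : ∀ M → IsModule (derivFunctor M) (derivAction M)) where

    derivModule : Module → Module
    derivModule M = record { M = derivFunctor M ; ρ = derivAction M ; isModule = isMod M }

    module _ (isLin : ∀ {M N} (τ : LinearNT M N) →
                IsNatural C D (derivFunctor M) (derivFunctor N) (derivComponents τ) ×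
                IsLinear (derivModule M) (derivModule N) (derivComponents τ)) where

      derivHom : ∀ {M N} → LinearNT M N → LinearNT (derivModule M) (derivModule N)
      derivHom τ with isLin τ
      ... | nat , lin = record { τ = derivComponents τ ; natural = nat ; linear = lin }

      derivationFunctor : IsFunctor Mod Mod derivModule derivHom → Functor Mod Mod
      derivationFunctor isFun = record { F₀ = derivModule ; F₁ = derivHom ; isFunctor = isFun }

module Submission where

-- γ is compatible with the monad structure: it is natural, γ ∘ Maybe η = η Maybe
-- and γ ∘ Maybe μ = μ Maybe ∘ Rγ ∘ γR.  With these, the module laws of M at
-- Maybe X give those of M′ at X, and linearity of τ Maybe follows from
-- linearity of τ and naturality of τ at γ.  Derivation is precomposition with
-- Maybe, so the functor laws hold on the nose.  Since D is cartesian, pointwise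
-- products of modules are modules, so terminal objects and binary products in
-- Mod^D(R) are exactly the pointwise ones; and M′ at X is M at Maybe X.

open import Defs
open import Level using (Level; _⊔_)
open import Data.Product using (Σ; Σ-syntax; _×_; _,_; proj₁; proj₂)
import Relation.Binary.Reasoning.Setoid as SetoidR

module CategoryLemmas {o ℓ e} (C : Category o ℓ e) where
  open Category C

  module HomReasoning {A B : Obj} where
    open SetoidR (hom-setoid {A} {B}) public
  open HomReasoning

  ∘-resp-≈ˡ : ∀ {A B X} {f h : B ⇒ X} {g : A ⇒ B} → f ≈ h → f ∘ g ≈ h ∘ g
  ∘-resp-≈ˡ p = ∘-resp-≈ p refl≈

  ∘-resp-≈ʳ : ∀ {A B X} {f : B ⇒ X} {g h : A ⇒ B} → g ≈ h → f ∘ g ≈ f ∘ h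
  ∘-resp-≈ʳ p = ∘-resp-≈ refl≈ p

  pullʳ : ∀ {A B X Y} {a : X ⇒ Y} {b : B ⇒ X} {c : A ⇒ B} {d : A ⇒ X} →
          b ∘ c ≈ d → (a ∘ b) ∘ c ≈ a ∘ d
  pullʳ p = trans≈ assoc (∘-resp-≈ʳ p)

  pullˡ : ∀ {A B X Y} {a : X ⇒ Y} {b : B ⇒ X} {c : A ⇒ B} {d : B ⇒ Y} →
          a ∘ b ≈ d → a ∘ (b ∘ c) ≈ d ∘ c
  pullˡ p = trans≈ (sym≈ assoc) (∘-resp-≈ˡ p)

  introˡ : ∀ {A B} {a : B ⇒ B} {f : A ⇒ B} → a ≈ id → f ≈ a ∘ f
  introˡ p = sym≈ (trans≈ (∘-resp-≈ˡ p) identityˡ)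

  !-unique₂ : ∀ {T Z} → IsTerminal C T → (f g : Z ⇒ T) → f ≈ g
  !-unique₂ {Z = Z} t f g = trans≈ (proj₂ (t Z) f) (sym≈ (proj₂ (t Z) g))

  retract-of-terminal : ∀ {T T′} (u : T ⇒ T′) (v : T′ ⇒ T) → v ∘ u ≈ id →
                        IsTerminal C T′ → IsTerminal C T
  retract-of-terminal u v vu t′ Z = v ∘ proj₁ (t′ Z) , λ h → begin
    h              ≈⟨ introˡ vu ⟩
    (v ∘ u) ∘ h    ≈⟨ pullʳ (!-unique₂ t′ _ _) ⟩
    v ∘ proj₁ (t′ Z) ∎

  module Product {A B P} {π₁ : P ⇒ A} {π₂ : P ⇒ B} (product : IsProduct C π₁ π₂) where

    ⟨_,_⟩ : ∀ {Q} → Q ⇒ A → Q ⇒ B → Q ⇒ P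
    ⟨ f , g ⟩ = proj₁ (product _ f g)

    project₁ : ∀ {Q} {f : Q ⇒ A} {g : Q ⇒ B} → π₁ ∘ ⟨ f , g ⟩ ≈ f
    project₁ {Q} {f} {g} = proj₁ (proj₂ (product Q f g))

    project₂ : ∀ {Q} {f : Q ⇒ A} {g : Q ⇒ B} → π₂ ∘ ⟨ f , g ⟩ ≈ g
    project₂ {Q} {f} {g} = proj₁ (proj₂ (proj₂ (product Q f g)))

    unique : ∀ {Q} {f : Q ⇒ A} {g : Q ⇒ B} {h : Q ⇒ P} →
             π₁ ∘ h ≈ f → π₂ ∘ h ≈ g → h ≈ ⟨ f , g ⟩
    unique {Q} {f} {g} {h} = proj₂ (proj₂ (proj₂ (product Q f g))) h

    unique′ : ∀ {Q} {h i : Q ⇒ P} → π₁ ∘ h ≈ π₁ ∘ i → π₂ ∘ h ≈ π₂ ∘ i → h ≈ i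
    unique′ p q = trans≈ (unique p q) (sym≈ (unique refl≈ refl≈))

  repack∘repack≈id : ∀ {A B P Q} {p₁ : P ⇒ A} {p₂ : P ⇒ B} {q₁ : Q ⇒ A} {q₂ : Q ⇒ B}
                     (Pp : IsProduct C p₁ p₂) (Qp : IsProduct C q₁ q₂) →
                     Product.⟨_,_⟩ Pp q₁ q₂ ∘ Product.⟨_,_⟩ Qp p₁ p₂ ≈ id
  repack∘repack≈id Pp Qp = P.unique′
    (trans≈ (pullˡ P.project₁) (trans≈ Q.project₁ (sym≈ identityʳ)))
    (trans≈ (pullˡ P.project₂) (trans≈ Q.project₂ (sym≈ identityʳ)))
    where
      module P = Product Pp
      module Q = Product Qp

  retract-of-product : ∀ {A B P Q} {p₁ : P ⇒ A} {p₂ : P ⇒ B} {q₁ : Q ⇒ A} {q₂ : Q ⇒ B}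
                       (u : Q ⇒ P) (v : P ⇒ Q) →
                       p₁ ∘ u ≈ q₁ → p₂ ∘ u ≈ q₂ → q₁ ∘ v ≈ p₁ → q₂ ∘ v ≈ p₂ → v ∘ u ≈ id →
                       IsProduct C p₁ p₂ → IsProduct C q₁ q₂
  retract-of-product u v pu₁ pu₂ qv₁ qv₂ vu Pp Z f g =
      v ∘ ⟨ f , g ⟩
    , trans≈ (pullˡ qv₁) project₁
    , trans≈ (pullˡ qv₂) project₂
    , λ h q₁h q₂h → begin
        h              ≈⟨ introˡ vu ⟩
        (v ∘ u) ∘ h    ≈⟨ pullʳ (unique (trans≈ (pullˡ pu₁) q₁h) (trans≈ (pullˡ pu₂) q₂h)) ⟩
        v ∘ ⟨ f , g ⟩  ∎
    where open Product Pp

  coproduct-ext : (cop : BinaryCoproducts C) → let open BinaryCoproducts cop in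
                  ∀ {A B X} {h k : (A + B) ⇒ X} → h ∘ i₁ ≈ k ∘ i₁ → h ∘ i₂ ≈ k ∘ i₂ → h ≈ k
  coproduct-ext cop p q = trans≈ (sym≈ (unique p q)) (unique refl≈ refl≈)
    where open BinaryCoproducts cop

  module BinaryProductLemmas (prods : BinaryProducts C) where
    open BinaryProducts prods
    module _ {A B : Obj} where
      open Product (product {A} {B}) public

    infixr 8 _⁂_
    _⁂_ : ∀ {A B A′ B′} → A ⇒ A′ → B ⇒ B′ → (A ×ₒ B) ⇒ (A′ ×ₒ B′)
    f ⁂ g = ⟨ f ∘ p₁ , g ∘ p₂ ⟩

    ⁂-cong₂ : ∀ {A B A′ B′} {f f′ : A ⇒ A′} {g g′ : B ⇒ B′} → f ≈ f′ → g ≈ g′ → f ⁂ g ≈ f′ ⁂ g′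
    ⁂-cong₂ p q = unique (trans≈ project₁ (∘-resp-≈ˡ p)) (trans≈ project₂ (∘-resp-≈ˡ q))

    ⁂∘⁂ : ∀ {A B A′ B′ A″ B″} {f : A′ ⇒ A″} {g : B′ ⇒ B″} {h : A ⇒ A′} {i : B ⇒ B′} →
          (f ⁂ g) ∘ (h ⁂ i) ≈ (f ∘ h) ⁂ (g ∘ i)
    ⁂∘⁂ = unique (trans≈ (pullˡ project₁) (trans≈ (pullʳ project₁) (sym≈ assoc)))
                 (trans≈ (pullˡ project₂) (trans≈ (pullʳ project₂) (sym≈ assoc)))

    id⁂id : ∀ {A B} → id {A} ⁂ id {B} ≈ id
    id⁂id = sym≈ (unique (trans≈ identityʳ (sym≈ identityˡ)) (trans≈ identityʳ (sym≈ identityˡ)))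

    ⁂-resp-square : ∀ {A B A′ B′ A″ B″ A‴ B‴}
                      {h : A ⇒ A′} {f : A′ ⇒ A‴} {h′ : A ⇒ A″} {f′ : A″ ⇒ A‴}
                      {i : B ⇒ B′} {g : B′ ⇒ B‴} {i′ : B ⇒ B″} {g′ : B″ ⇒ B‴} →
                    f ∘ h ≈ f′ ∘ h′ → g ∘ i ≈ g′ ∘ i′ →
                    (f ⁂ g) ∘ (h ⁂ i) ≈ (f′ ⁂ g′) ∘ (h′ ⁂ i′)
    ⁂-resp-square p q = trans≈ ⁂∘⁂ (trans≈ (⁂-cong₂ p q) (sym≈ ⁂∘⁂))

module ModuleLemmas {o ℓ e o′ ℓ′ e′}
  (C : Category o ℓ e) (D : Category o′ ℓ′ e′) (RM : Monad C) where
  private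
    module C = Category C
    module D = Category D
  open Monad RM
  open Modules C D RM
  open D using (_∘_; _≈_; sym≈; trans≈)
  open CategoryLemmas D
  open HomReasoning
  open LinearNT

  IsPointwiseTerminal : Module → Set (o ⊔ o′ ⊔ ℓ′ ⊔ e′)
  IsPointwiseTerminal T = ∀ X → IsTerminal D (Module.M₀ T X)

  IsPointwiseProduct : ∀ {P A B} → LinearNT P A → LinearNT P B → Set (o ⊔ o′ ⊔ ℓ′ ⊔ e′)
  IsPointwiseProduct π₁ π₂ = ∀ X → IsProduct D (τ π₁ X) (τ π₂ X)

  pointwise-terminal⇒terminal : ∀ {T} → IsPointwiseTerminal T → IsTerminal Mod T
  pointwise-terminal⇒terminal t M =
      record { τ       = λ X → proj₁ (t X _)
             ; natural = λ f → !-unique₂ (t _) _ _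
             ; linear  = λ X → !-unique₂ (t X) _ _ }
    , λ h → ≈ᴸ-intro (λ X → proj₂ (t X _) (τ h X))

  module _ {P Q A : Module} (π : LinearNT P A) (f : LinearNT Q A)
           (h : ∀ X → Module.M₀ Q X D.⇒ Module.M₀ P X)
           (πh≈f : ∀ X → τ π X ∘ h X ≈ τ f X) where
    private
      module P = Module P
      module Q = Module Q
      module A = Module A

    projected-naturality : ∀ {X Y} (g : X C.⇒ Y) →
                           τ π Y ∘ (h Y ∘ Q.M₁ g) ≈ τ π Y ∘ (P.M₁ g ∘ h X)
    projected-naturality {X} {Y} g = begin
      τ π Y ∘ (h Y ∘ Q.M₁ g)   ≈⟨ pullˡ (πh≈f Y) ⟩
      τ f Y ∘ Q.M₁ g           ≈⟨ natural f g ⟩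
      A.M₁ g ∘ τ f X           ≈⟨ ∘-resp-≈ʳ (πh≈f X) ⟨
      A.M₁ g ∘ (τ π X ∘ h X)   ≈⟨ D.assoc ⟨
      (A.M₁ g ∘ τ π X) ∘ h X   ≈⟨ ∘-resp-≈ˡ (natural π g) ⟨
      (τ π Y ∘ P.M₁ g) ∘ h X   ≈⟨ D.assoc ⟩
      τ π Y ∘ (P.M₁ g ∘ h X)   ∎

    projected-linearity : ∀ X → τ π X ∘ (P.ρ X ∘ h (R₀ X)) ≈ τ π X ∘ (h X ∘ Q.ρ X)
    projected-linearity X = begin
      τ π X ∘ (P.ρ X ∘ h (R₀ X))       ≈⟨ D.assoc ⟨
      (τ π X ∘ P.ρ X) ∘ h (R₀ X)       ≈⟨ ∘-resp-≈ˡ (linear π X) ⟨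
      (A.ρ X ∘ τ π (R₀ X)) ∘ h (R₀ X)  ≈⟨ pullʳ (πh≈f (R₀ X)) ⟩
      A.ρ X ∘ τ f (R₀ X)               ≈⟨ linear f X ⟩
      τ f X ∘ Q.ρ X                    ≈⟨ ∘-resp-≈ˡ (πh≈f X) ⟨
      (τ π X ∘ h X) ∘ Q.ρ X            ≈⟨ D.assoc ⟩
      τ π X ∘ (h X ∘ Q.ρ X)            ∎

  pointwise-product⇒product : ∀ {P A B} {π₁ : LinearNT P A} {π₂ : LinearNT P B} →
                              IsPointwiseProduct π₁ π₂ → IsProduct Mod π₁ π₂
  pointwise-product⇒product {P} {π₁ = π₁} {π₂} pp Q f g =
      record
        { τ       = h
        ; natural = λ k → Pr.unique′ (projected-naturality π₁ f h (λ _ → Pr.project₁) k)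
                                     (projected-naturality π₂ g h (λ _ → Pr.project₂) k)
        ; linear  = λ X → Pr.unique′ (projected-linearity π₁ f h (λ _ → Pr.project₁) X)
                                     (projected-linearity π₂ g h (λ _ → Pr.project₂) X) }
    , ≈ᴸ-intro (λ _ → Pr.project₁)
    , ≈ᴸ-intro (λ _ → Pr.project₂)
    , λ _ p q → ≈ᴸ-intro (λ X → Pr.unique (_≈ᴸ_.pointwise p X) (_≈ᴸ_.pointwise q X))
    where
      module Pr {X} = Product (pp X)
      h : ∀ X → Module.M₀ Q X D.⇒ Module.M₀ P X
      h X = Pr.⟨ τ f X , τ g X ⟩

  module _ (dterm : Terminal D) where
    open Terminal dterm

    terminalModule : Module
    terminalModule = record
      { M        = record
        { F₀        = λ _ → ⊤
        ; F₁        = λ _ → D.id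
        ; isFunctor = record { identity     = D.refl≈
                             ; homomorphism = sym≈ D.identityˡ
                             ; F-resp-≈     = λ _ → D.refl≈ } }
      ; ρ        = λ _ → D.id
      ; isModule = record { ρ-natural = λ _ → D.refl≈
                          ; ρ-assoc   = D.refl≈
                          ; ρ-unit    = D.identityˡ } }

    terminal⇒pointwise-terminal : ∀ {T} → IsTerminal Mod T → IsPointwiseTerminal T
    terminal⇒pointwise-terminal {T} t X =
      retract-of-terminal (τ u X) (τ v X) (_≈ᴸ_.pointwise vu X) ⊤-terminal
      where
        u : LinearNT T terminalModule
        u = proj₁ (pointwise-terminal⇒terminal (λ _ → ⊤-terminal) T)
        v : LinearNT terminalModule T
        v = proj₁ (t terminalModule)
        vu : (v ∘ᴸ u) ≈ᴸ idᴸ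
        vu = CategoryLemmas.!-unique₂ Mod t (v ∘ᴸ u) idᴸ

  module _ (dprod : BinaryProducts D) where
    open BinaryProducts dprod
    open BinaryProductLemmas dprod

    infixr 7 _×ᴹ_
    _×ᴹ_ : Module → Module → Module
    A ×ᴹ B = record
      { M        = record
        { F₀        = λ X → A.M₀ X ×ₒ B.M₀ X
        ; F₁        = λ f → A.M₁ f ⁂ B.M₁ f
        ; isFunctor = record
          { identity     = trans≈ (⁂-cong₂ A.identity B.identity) id⁂id
          ; homomorphism = trans≈ (⁂-cong₂ A.homomorphism B.homomorphism) (sym≈ ⁂∘⁂)
          ; F-resp-≈     = λ p → ⁂-cong₂ (A.F-resp-≈ p) (B.F-resp-≈ p) } }
      ; ρ        = λ X → A.ρ X ⁂ B.ρ X
      ; isModule = record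
        { ρ-natural = λ f → ⁂-resp-square (A.ρ-natural f) (B.ρ-natural f)
        ; ρ-assoc   = ⁂-resp-square A.ρ-assoc B.ρ-assoc
        ; ρ-unit    = trans≈ ⁂∘⁂ (trans≈ (⁂-cong₂ A.ρ-unit B.ρ-unit) id⁂id) } }
      where
        module A = Module A
        module B = Module B

    π₁ᴹ : ∀ {A B} → LinearNT (A ×ᴹ B) A
    π₁ᴹ = record { τ = λ _ → p₁ ; natural = λ _ → project₁ ; linear = λ _ → sym≈ project₁ }

    π₂ᴹ : ∀ {A B} → LinearNT (A ×ᴹ B) B
    π₂ᴹ = record { τ = λ _ → p₂ ; natural = λ _ → project₂ ; linear = λ _ → sym≈ project₂ }

    product⇒pointwise-product : ∀ {P A B} {π₁ : LinearNT P A} {π₂ : LinearNT P B} →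
                                IsProduct Mod π₁ π₂ → IsPointwiseProduct π₁ π₂
    product⇒pointwise-product {P} {A} {B} {π₁} {π₂} Pp X =
      retract-of-product (τ u X) (τ v X)
        (pointwise (S×.project₁ {f = π₁} {π₂}) X) (pointwise (S×.project₂ {f = π₁} {π₂}) X)
        (pointwise (P×.project₁ {f = π₁ᴹ} {π₂ᴹ}) X) (pointwise (P×.project₂ {f = π₁ᴹ} {π₂ᴹ}) X)
        (pointwise v∘u≈id X)
        product
      where
        open _≈ᴸ_
        Sp : IsProduct Mod (π₁ᴹ {A} {B}) π₂ᴹ
        Sp = pointwise-product⇒product (λ _ → product)
        module S× = CategoryLemmas.Product Mod Sp
        module P× = CategoryLemmas.Product Mod Pp
        u : LinearNT P (A ×ᴹ B)
        u = S×.⟨ π₁ , π₂ ⟩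
        v : LinearNT (A ×ᴹ B) P
        v = P×.⟨ π₁ᴹ , π₂ᴹ ⟩
        v∘u≈id : (v ∘ᴸ u) ≈ᴸ idᴸ
        v∘u≈id = CategoryLemmas.repack∘repack≈id Mod Pp Sp

module DerivativeLemmas {o ℓ e o′ ℓ′ e′}
  (C : Category o ℓ e) (D : Category o′ ℓ′ e′)
  (cop : BinaryCoproducts C) (term : Terminal C) (RM : Monad C) where
  private
    module C = Category C
    module D = Category D
  open BinaryCoproducts cop
  open Monad RM
  open Modules C D RM
  open Derivation C D cop term RM

  module _ where
    open C using (_∘_; _≈_)
    open CategoryLemmas C
    open HomReasoning

    γ-natural : ∀ {X Y} (f : X C.⇒ Y) → γ Y ∘ Maybe₁ (R₁ f) ≈ R₁ (Maybe₁ f) ∘ γ X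
    γ-natural {X} {Y} f = coproduct-ext cop
      (begin
        (γ Y ∘ Maybe₁ (R₁ f)) ∘ i₁    ≈⟨ pullʳ inject₁ ⟩
        γ Y ∘ (i₁ ∘ R₁ f)             ≈⟨ pullˡ inject₁ ⟩
        R₁ i₁ ∘ R₁ f                  ≈⟨ homomorphism ⟨
        R₁ (i₁ ∘ f)                   ≈⟨ F-resp-≈ inject₁ ⟨
        R₁ (Maybe₁ f ∘ i₁)            ≈⟨ homomorphism ⟩
        R₁ (Maybe₁ f) ∘ R₁ i₁         ≈⟨ pullʳ inject₁ ⟨
        (R₁ (Maybe₁ f) ∘ γ X) ∘ i₁    ∎)
      (begin
        (γ Y ∘ Maybe₁ (R₁ f)) ∘ i₂    ≈⟨ pullʳ inject₂ ⟩
        γ Y ∘ i₂                      ≈⟨ inject₂ ⟩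
        η (Maybe₀ Y) ∘ i₂             ≈⟨ ∘-resp-≈ʳ inject₂ ⟨
        η (Maybe₀ Y) ∘ (Maybe₁ f ∘ i₂) ≈⟨ pullˡ (η-natural (Maybe₁ f)) ⟩
        (R₁ (Maybe₁ f) ∘ η (Maybe₀ X)) ∘ i₂ ≈⟨ C.assoc ⟩
        R₁ (Maybe₁ f) ∘ (η (Maybe₀ X) ∘ i₂) ≈⟨ pullʳ inject₂ ⟨
        (R₁ (Maybe₁ f) ∘ γ X) ∘ i₂    ∎)

    γ-unit : ∀ {X} → γ X ∘ Maybe₁ (η X) ≈ η (Maybe₀ X)
    γ-unit {X} = coproduct-ext cop
      (begin
        (γ X ∘ Maybe₁ (η X)) ∘ i₁   ≈⟨ pullʳ inject₁ ⟩
        γ X ∘ (i₁ ∘ η X)            ≈⟨ pullˡ inject₁ ⟩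
        R₁ i₁ ∘ η X                 ≈⟨ η-natural i₁ ⟨
        η (Maybe₀ X) ∘ i₁           ∎)
      (C.trans≈ (pullʳ inject₂) inject₂)

    γ-mult : ∀ {X} → γ X ∘ Maybe₁ (μ X) ≈ μ (Maybe₀ X) ∘ (R₁ (γ X) ∘ γ (R₀ X))
    γ-mult {X} = coproduct-ext cop
      (begin
        (γ X ∘ Maybe₁ (μ X)) ∘ i₁                   ≈⟨ pullʳ inject₁ ⟩
        γ X ∘ (i₁ ∘ μ X)                            ≈⟨ pullˡ inject₁ ⟩
        R₁ i₁ ∘ μ X                                 ≈⟨ μ-natural i₁ ⟨
        μ (Maybe₀ X) ∘ R₁ (R₁ i₁)                   ≈⟨ ∘-resp-≈ʳ (F-resp-≈ inject₁) ⟨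
        μ (Maybe₀ X) ∘ R₁ (γ X ∘ i₁)                ≈⟨ ∘-resp-≈ʳ homomorphism ⟩
        μ (Maybe₀ X) ∘ (R₁ (γ X) ∘ R₁ i₁)           ≈⟨ ∘-resp-≈ʳ (pullʳ inject₁) ⟨
        μ (Maybe₀ X) ∘ ((R₁ (γ X) ∘ γ (R₀ X)) ∘ i₁) ≈⟨ C.assoc ⟨
        (μ (Maybe₀ X) ∘ (R₁ (γ X) ∘ γ (R₀ X))) ∘ i₁ ∎)
      (begin
        (γ X ∘ Maybe₁ (μ X)) ∘ i₂                   ≈⟨ pullʳ inject₂ ⟩
        γ X ∘ i₂                                    ≈⟨ introˡ μ-unitˡ ⟩
        (μ (Maybe₀ X) ∘ η (R₀ (Maybe₀ X))) ∘ (γ X ∘ i₂) ≈⟨ pullʳ (pullˡ (η-natural (γ X))) ⟩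
        μ (Maybe₀ X) ∘ ((R₁ (γ X) ∘ η (Maybe₀ (R₀ X))) ∘ i₂) ≈⟨ ∘-resp-≈ʳ C.assoc ⟩
        μ (Maybe₀ X) ∘ (R₁ (γ X) ∘ (η (Maybe₀ (R₀ X)) ∘ i₂)) ≈⟨ ∘-resp-≈ʳ (pullʳ inject₂) ⟨
        μ (Maybe₀ X) ∘ ((R₁ (γ X) ∘ γ (R₀ X)) ∘ i₂) ≈⟨ C.assoc ⟨
        (μ (Maybe₀ X) ∘ (R₁ (γ X) ∘ γ (R₀ X))) ∘ i₂ ∎)

  open D using (_∘_; _≈_)
  open CategoryLemmas D
  open HomReasoning

  derivative-isModule : ∀ M → IsModule (derivFunctor M) (derivAction M)
  derivative-isModule M = record
    { ρ-natural = ρ′-natural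
    ; ρ-assoc   = ρ′-assoc
    ; ρ-unit    = ρ′-unit }
    where
      open Module M using (M₁; ρ; ρ-natural; ρ-assoc; ρ-unit)
        renaming (homomorphism to M-homomorphism; F-resp-≈ to M-resp-≈)

      ρ′-natural : ∀ {X Y} (f : X C.⇒ Y) →
                   derivAction M Y ∘ M₁ (Maybe₁ (R₁ f)) ≈ M₁ (Maybe₁ f) ∘ derivAction M X
      ρ′-natural {X} {Y} f = begin
        (ρ (Maybe₀ Y) ∘ M₁ (γ Y)) ∘ M₁ (Maybe₁ (R₁ f))  ≈⟨ pullʳ (D.sym≈ M-homomorphism) ⟩
        ρ (Maybe₀ Y) ∘ M₁ (γ Y C.∘ Maybe₁ (R₁ f))       ≈⟨ ∘-resp-≈ʳ (M-resp-≈ (γ-natural f)) ⟩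
        ρ (Maybe₀ Y) ∘ M₁ (R₁ (Maybe₁ f) C.∘ γ X)       ≈⟨ ∘-resp-≈ʳ M-homomorphism ⟩
        ρ (Maybe₀ Y) ∘ (M₁ (R₁ (Maybe₁ f)) ∘ M₁ (γ X))  ≈⟨ pullˡ (ρ-natural (Maybe₁ f)) ⟩
        (M₁ (Maybe₁ f) ∘ ρ (Maybe₀ X)) ∘ M₁ (γ X)       ≈⟨ D.assoc ⟩
        M₁ (Maybe₁ f) ∘ (ρ (Maybe₀ X) ∘ M₁ (γ X))       ∎

      ρ′-assoc : ∀ {X} → derivAction M X ∘ M₁ (Maybe₁ (μ X)) ≈
                         derivAction M X ∘ derivAction M (R₀ X)
      ρ′-assoc {X} = begin
        (ρ X′ ∘ M₁ (γ X)) ∘ M₁ (Maybe₁ (μ X))                     ≈⟨ pullʳ (D.sym≈ M-homomorphism) ⟩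
        ρ X′ ∘ M₁ (γ X C.∘ Maybe₁ (μ X))                          ≈⟨ ∘-resp-≈ʳ (M-resp-≈ γ-mult) ⟩
        ρ X′ ∘ M₁ (μ X′ C.∘ (R₁ (γ X) C.∘ γ (R₀ X)))              ≈⟨ ∘-resp-≈ʳ M-homomorphism ⟩
        ρ X′ ∘ (M₁ (μ X′) ∘ M₁ (R₁ (γ X) C.∘ γ (R₀ X)))           ≈⟨ pullˡ ρ-assoc ⟩
        (ρ X′ ∘ ρ (R₀ X′)) ∘ M₁ (R₁ (γ X) C.∘ γ (R₀ X))           ≈⟨ pullʳ (∘-resp-≈ʳ M-homomorphism) ⟩
        ρ X′ ∘ (ρ (R₀ X′) ∘ (M₁ (R₁ (γ X)) ∘ M₁ (γ (R₀ X))))      ≈⟨ ∘-resp-≈ʳ (pullˡ (ρ-natural (γ X))) ⟩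
        ρ X′ ∘ ((M₁ (γ X) ∘ ρ (Maybe₀ (R₀ X))) ∘ M₁ (γ (R₀ X)))   ≈⟨ ∘-resp-≈ʳ D.assoc ⟩
        ρ X′ ∘ (M₁ (γ X) ∘ derivAction M (R₀ X))                  ≈⟨ D.assoc ⟨
        (ρ X′ ∘ M₁ (γ X)) ∘ derivAction M (R₀ X)                  ∎
        where X′ = Maybe₀ X

      ρ′-unit : ∀ {X} → derivAction M X ∘ M₁ (Maybe₁ (η X)) ≈ D.id
      ρ′-unit {X} = begin
        (ρ (Maybe₀ X) ∘ M₁ (γ X)) ∘ M₁ (Maybe₁ (η X))  ≈⟨ pullʳ (D.sym≈ M-homomorphism) ⟩
        ρ (Maybe₀ X) ∘ M₁ (γ X C.∘ Maybe₁ (η X))       ≈⟨ ∘-resp-≈ʳ (M-resp-≈ γ-unit) ⟩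
        ρ (Maybe₀ X) ∘ M₁ (η (Maybe₀ X))               ≈⟨ ρ-unit ⟩
        D.id                                           ∎

  derivComponents-natural : ∀ {M N} (τ : LinearNT M N) →
                            IsNatural C D (derivFunctor M) (derivFunctor N) (derivComponents τ)
  derivComponents-natural τ f = LinearNT.natural τ (Maybe₁ f)

  derivComponents-linear : ∀ {M N} (τ : LinearNT M N) →
                           IsLinear (derivModule derivative-isModule M)
                                    (derivModule derivative-isModule N) (derivComponents τ)
  derivComponents-linear {M} {N} σ X = begin
    (N.ρ X′ ∘ N.M₁ (γ X)) ∘ τ (Maybe₀ (R₀ X))  ≈⟨ pullʳ (D.sym≈ (natural (γ X))) ⟩
    N.ρ X′ ∘ (τ (R₀ X′) ∘ M.M₁ (γ X))          ≈⟨ pullˡ (linear X′) ⟩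
    (τ X′ ∘ M.ρ X′) ∘ M.M₁ (γ X)               ≈⟨ D.assoc ⟩
    τ X′ ∘ (M.ρ X′ ∘ M.M₁ (γ X))               ∎
    where
      module M = Module M
      module N = Module N
      open LinearNT σ
      X′ = Maybe₀ X

  derivHom-isLinearNT : ∀ {M N} (τ : LinearNT M N) →
                        IsNatural C D (derivFunctor M) (derivFunctor N) (derivComponents τ) ×
                        IsLinear (derivModule derivative-isModule M)
                                 (derivModule derivative-isModule N) (derivComponents τ)
  derivHom-isLinearNT τ = derivComponents-natural τ , derivComponents-linear τ

  derivation-isFunctor : IsFunctor Mod Mod (derivModule derivative-isModule)
                                           (derivHom derivative-isModule derivHom-isLinearNT)
  derivation-isFunctor = record
    { identity     = ≈ᴸ-intro (λ _ → D.refl≈)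
    ; homomorphism = ≈ᴸ-intro (λ _ → D.refl≈)
    ; F-resp-≈     = λ p → ≈ᴸ-intro (λ X → _≈ᴸ_.pointwise p (Maybe₀ X)) }

  derivation-preservesFiniteProducts :
    Terminal D → BinaryProducts D →
    PreservesFiniteProducts Mod Mod
      (derivationFunctor derivative-isModule derivHom-isLinearNT derivation-isFunctor)
  derivation-preservesFiniteProducts dterm dprod =
      (λ T t → pointwise-terminal⇒terminal
                 (λ X → terminal⇒pointwise-terminal dterm t (Maybe₀ X)))
    , (λ π₁ π₂ pr → pointwise-product⇒product
                      (λ X → product⇒pointwise-product dprod pr (Maybe₀ X)))
    where open ModuleLemmas C D RM

proposition1 : ∀ {o ℓ e o' ℓ' e' : Level}
    (C : Category o ℓ e) (D : Category o' ℓ' e')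
    (cop : BinaryCoproducts C) (init : Initial C) (term : Terminal C)
    (dterm : Terminal D) (dprod : BinaryProducts D)
    (RM : Monad C) →
    let open Modules C D RM in
    let open Derivation C D cop term RM in
    Σ[ isMod ∈ (∀ M → IsModule (derivFunctor M) (derivAction M)) ]
    Σ[ isLin ∈ (∀ {M N} (τ : LinearNT M N) →
                 IsNatural C D (derivFunctor M) (derivFunctor N) (derivComponents τ) ×
                 IsLinear (derivModule isMod M) (derivModule isMod N) (derivComponents τ)) ]
    Σ[ isFun ∈ IsFunctor Mod Mod (derivModule isMod) (derivHom isMod isLin) ]
    PreservesFiniteProducts Mod Mod (derivationFunctor isMod isLin isFun)
proposition1 C D cop _ term dterm dprod RM =
    derivative-isModule
  , derivHom-isLinearNT
  , derivation-isFunctor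
  , derivation-preservesFiniteProducts dterm dprod
  where open DerivativeLemmas C D cop term RM
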